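{- Let $\mathbb{K}$ be a semiring, let $f\colon\mathbb{N}^d\to\mathbb{K}$ be an $(\boldsymbol{\mathcal{S}},\mathbb{K})$-regular sequence and let $g\colon\mathbb{N}^d\to\mathbb{K}$ be such that $g(\boldsymbol{n})=f(\boldsymbol{n})$ for all but finitely many $\boldsymbol{n}\in\mathbb{N}^d$. Then $g$ is $(\boldsymbol{\mathcal{S}},\mathbb{K})$-regular.
   Context: An abstract numeration system is a triple $\mathcal{S}=(L,A,<)$ where $L$ is an infinite regular language over a finite alphabet $A$ totally ordered by $<$. Words are ordered by the radix order ($u<_{\rm rad}v$ iff $|u|<|v|$, or $|u|=|v|$ and $u$ is lexicographically smaller); $\mathrm{rep}_{\mathcal{S}}\colon\mathbb{N}\to L$ maps $n$ to the $n$-th word of $L$ (indexing from $0$) and $\mathrm{val}_{\mathcal{S}}$ is its inverse. Fix $d\ge1$, abstract numeration systems $\mathcal{S}_i=(L_i,A_i,<_i)$ for $i\in\{1,\dots,d\}$, $\boldsymbol{\mathcal{S}}=(\mathcal{S}_1,\dots,\mathcal{S}_d)$, and a symbol $\#\notin A_1\cup\dots\cup A_d$. Let $\boldsymbol{\#}=(\#,\dots,\#)$ and $\boldsymbol{A}=\big((A_1\cup\{\#\})\times\cdots\times(A_d\cup\{\#\})\big)\setminus\{\boldsymbol{\#}\}$. For words $w_1,\dots,w_d$, $(w_1,\dots,w_d)^\#$ is the word over $\boldsymbol{A}$ obtained by left-padding each $w_i$ with $\#$'s to the maximal length and reading them in parallel. Let $\boldsymbol{L}=\{(w_1,\dots,w_d)^\#: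 w_i\in L_i\}$, $\mathrm{rep}_{\boldsymbol{\mathcal{S}}}(n_1,\dots,n_d)=(\mathrm{rep}_{\mathcal{S}_1}(n_1),\dots,\mathrm{rep}_{\mathcal{S}_d}(n_d))^\#$ (a bijection $\mathbb{N}^d\to\boldsymbol{L}$), $\mathrm{val}_{\boldsymbol{\mathcal{S}}}$ its inverse. A series $S\colon A^*\to\mathbb{K}$ is $\mathbb{K}$-recognizable if there exist $r\ge1$, a monoid morphism $\mu\colon A^*\to\mathbb{K}^{r\times r}$, $\lambda\in\mathbb{K}^{1\times r}$, $\gamma\in\mathbb{K}^{r\times1}$ with $(S,w)=\lambda\mu(w)\gamma$ for all $w$. A sequence $f\colon\mathbb{N}^d\to\mathbb{K}$ is $(\boldsymbol{\mathcal{S}},\mathbb{K})$-regular if the series $\sum_{\boldsymbol{w}\in\boldsymbol{L}}f(\mathrm{val}_{\boldsymbol{\mathcal{S}}}(\boldsymbol{w}))\,\boldsymbol{w}$ over $\boldsymbol{A}$ is $\mathbb{K}$-recognizable. -}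

module Defs where

open import Level using (Level)
open import Data.Nat using (ℕ; zero; suc; _∸_; _≤_; _<ᵇ_; _⊔_) renaming (_≡ᵇ_ to _==_; _+_ to _+ℕ_)
open import Data.Bool using (Bool; true; false; _∧_; _∨_; if_then_else_)
open import Data.Fin using (Fin; toℕ)
open import Data.Maybe using (Maybe; just; nothing)
open import Data.List using (List; []; _∷_; length; map; filter; concatMap; foldr; upTo; allFin; _++_)
open import Data.List.Relation.Unary.All using (All)
open import Data.List.Relation.Binary.Pointwise using (Pointwise)
open import Data.List.Membership.Propositional using (_∉_)
open import Data.Vec using (Vec; tabulate)
open import Data.Product using (Σ; ∃; _×_; _,_)
open import Relation.Binary.PropositionalEquality using (_≡_)
open import Relation.Nullary using (¬_)
open import Relation.Nullary.Decidable using (⌊_⌋)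
open import Data.Bool.Properties using (T?)
open import Data.Bool using (T)
open import Algebra.Bundles using (Semiring)

-- Finite totally ordered alphabets are modelled as Fin k with the
-- natural order on Fin.  A regular language is given by a complete DFA.

record DFA (k : ℕ) : Set where
  field
    nQ     : ℕ
    q₀     : Fin nQ
    δ      : Fin nQ → Fin k → Fin nQ
    final  : Fin nQ → Bool

  run : Fin nQ → List (Fin k) → Fin nQ
  run q []       = q
  run q (a ∷ w)  = run (δ q a) w

  accepts : List (Fin k) → Bool
  accepts w = final (run q₀ w)

record ANS : Set where
  field
    k        : ℕ
    dfa      : DFA k
  open DFA dfa public
  field
    infinite : ∀ (N : ℕ) → ∃ λ (w : List (Fin k)) → (N ≤ length w) × (accepts w ≡ true)

open ANS public

-- lexicographic strict order on words (used only for equal lengths)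
lexLt : ∀ {k} → List (Fin k) → List (Fin k) → Bool
lexLt []       []       = false
lexLt []       (_ ∷ _)  = true
lexLt (_ ∷ _)  []       = false
lexLt (a ∷ u)  (b ∷ v)  = (toℕ a <ᵇ toℕ b) ∨ ((toℕ a == toℕ b) ∧ lexLt u v)

radLt : ∀ {k} → List (Fin k) → List (Fin k) → Bool
radLt u v = (length u <ᵇ length v) ∨ ((length u == length v) ∧ lexLt u v)

wordsOfLength : ∀ k → ℕ → List (List (Fin k))
wordsOfLength k zero    = [] ∷ []
wordsOfLength k (suc l) = concatMap (λ a → map (a ∷_) (wordsOfLength k l)) (allFin k)

wordsUpTo : ∀ k → ℕ → List (List (Fin k))
wordsUpTo k l = concatMap (wordsOfLength k) (upTo (suc l))

-- val_S(w) = number of words of L that are radix-smaller than w;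
-- for w ∈ L this is the unique n with rep_S(n) = w (n-th word, from 0).
val : (S : ANS) → List (Fin (k S)) → ℕ
val S w = length (filter (λ v → T? (accepts S v ∧ radLt v w)) (wordsUpTo (k S) (length w)))

-- letters of the alphabet (A₁ ∪ {#}) × ⋯ × (A_d ∪ {#}); `nothing` is #
Letter : ∀ {d} → (Fin d → ANS) → Set
Letter {d} S = (i : Fin d) → Maybe (Fin (k (S i)))

-- letter different from (#,…,#), i.e. a letter of the bold alphabet A
NotAllHash : ∀ {d} {S : Fin d → ANS} → Letter S → Set
NotAllHash {d} a = ¬ (∀ (i : Fin d) → a i ≡ nothing)

_≈L_ : ∀ {d} {S : Fin d → ANS} → Letter S → Letter S → Set
_≈L_ {d} a b = ∀ (i : Fin d) → a i ≡ b i

Words : ∀ {d} → (Fin d → ANS) → Set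
Words {d} S = (i : Fin d) → List (Fin (k (S i)))

InL : ∀ {d} (S : Fin d → ANS) → Words S → Set
InL {d} S ws = ∀ (i : Fin d) → accepts (S i) (ws i) ≡ true

nth : ∀ {a} {A : Set a} → List A → ℕ → Maybe A
nth []       _       = nothing
nth (x ∷ xs) zero    = just x
nth (x ∷ xs) (suc j) = nth xs j

maxLen : ∀ {d} (S : Fin d → ANS) → Words S → ℕ
maxLen {d} S ws = foldr (λ i m → length (ws i) ⊔ m) 0 (allFin d)

-- (w₁,…,w_d)^# : left-pad with # to the maximal length M, read in parallel.
-- Position j (0 ≤ j < M) of component i is # if j < M - |wᵢ|, and the
-- (j - (M - |wᵢ|))-th letter of wᵢ otherwise.
pad : ∀ {d} (S : Fin d → ANS) → Words S → List (Letter S)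
pad S ws = map (λ j i → if (j +ℕ length (ws i)) <ᵇ M then nothing
                         else nth (ws i) ((j +ℕ length (ws i)) ∸ M))
               (upTo M)
  where M = maxLen S ws

vals : ∀ {d} (S : Fin d → ANS) → Words S → Vec ℕ d
vals S ws = tabulate (λ i → val (S i) (ws i))

module _ {c ℓ} (K : Semiring c ℓ) where
  open Semiring K

  Mat : ℕ → Set c
  Mat r = Fin r → Fin r → Carrier

  ∑ : ∀ r → (Fin r → Carrier) → Carrier
  ∑ r f = foldr (λ i s → f i + s) 0# (allFin r)

  _⊗_ : ∀ {r} → Mat r → Mat r → Mat r
  _⊗_ {r} A B i j = ∑ r (λ l → A i l * B l j)

  identity : ∀ {r} → Mat r
  identity i j = if ⌊ i Data.Fin.≟ j ⌋ then 1# else 0#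

  μ* : ∀ {r} {X : Set} → (X → Mat r) → List X → Mat r
  μ* μ []      = identity
  μ* μ (a ∷ w) = μ a ⊗ μ* μ w

  evalRep : ∀ {r} {X : Set} → (Fin r → Carrier) → (X → Mat r) → (Fin r → Carrier) → List X → Carrier
  evalRep {r} λv μ γ w = ∑ r (λ i → ∑ r (λ j → λv i * (μ* μ w i j * γ j)))

  -- f is (S,K)-regular: the series  ∑_{w ∈ L} f(val_S(w)) w  over the bold
  -- alphabet is K-recognizable.
  Regular : ∀ {d} → (S : Fin d → ANS) → (Vec ℕ d → Carrier) → Set (c Level.⊔ ℓ)
  Regular {d} S f =
    ∃ λ (r : ℕ) → ∃ λ (μ : Letter S → Mat r) →
    ∃ λ (λv : Fin r → Carrier) → ∃ λ (γ : Fin r → Carrier) →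
      (∀ (ws : Words S) → InL S ws → evalRep λv μ γ (pad S ws) ≈ f (vals S ws))
    × (∀ (w : List (Letter S)) → All (NotAllHash {S = S}) w →
         (∀ (ws : Words S) → InL S ws → ¬ Pointwise (_≈L_ {S = S}) w (pad S ws)) →
         evalRep λv μ γ w ≈ 0#)

  AlmostEqual : ∀ {d} → (Vec ℕ d → Carrier) → (Vec ℕ d → Carrier) → Set ℓ
  AlmostEqual {d} g f = ∃ λ (E : List (Vec ℕ d)) → ∀ (n : Vec ℕ d) → n ∉ E → g n ≈ f n

-- The series of g agrees with the series F of f except on the padded tuples whose value
-- lies in the finite set E. Since val grows without bound along longer and longer accepted words,
-- such tuples consist of words of length at most some N. Hence the series of g is F restricted to
-- words longer than N (a Hadamard product with a counting automaton, which needs no subtraction in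
-- the semiring) plus a finitely supported series listing g on the padded tuples of length at most N.
-- A finitely supported series is a sum of single-word series, each of which is recognizable.

module Submission where

open import Defs
open import Algebra.Bundles using (Semiring)
open import Data.Bool using (Bool; true; false; T; _∧_; _∨_; if_then_else_)
open import Data.Bool.Properties using (T?; T-∧; T-∨; T-≡) renaming (_≟_ to _≟ᵇ_)
open import Data.Fin as Fin using (Fin; zero; suc; toℕ; _↑ˡ_; _↑ʳ_; splitAt; combine; remQuot)
open import Data.Fin.Properties using (all?; remQuot-combine; toℕ≤pred[n])
open import Data.List as List
  using (List; []; _∷_; length; map; foldr; foldl; filter; deduplicate; concatMap; tabulate;
         upTo; applyUpTo; allFin; catMaybes; mapMaybe)
import Data.List.Properties as Listₚ
open import Data.List.Membership.Propositional using (_∈_; _∉_; find)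
open import Data.List.Membership.Propositional.Properties
  using (∈-map⁺; ∈-map⁻; ∈-concatMap⁺; ∈-concatMap⁻; ∈-allFin; ∈-upTo⁺; ∈-upTo⁻;
         ∈-filter⁺; ∈-filter⁻)
open import Data.List.Relation.Binary.Pointwise as Pointwise using (Pointwise)
open import Data.List.Relation.Unary.All as All using (All; []; _∷_)
import Data.List.Relation.Unary.All.Properties as Allₚ
open import Data.List.Relation.Unary.Any as Any using (Any; here; there)
import Data.List.Relation.Unary.Any.Properties as Anyₚ
open import Data.Maybe using (Maybe; nothing)
open import Data.Maybe.Properties using (≡-dec)
open import Data.Nat as ℕ using (ℕ; zero; suc; _≤_; _<_; z≤n; s≤s; _<ᵇ_)
import Data.Nat.Properties as ℕₚ
open import Data.Product using (∃-syntax; Σ-syntax; _×_; _,_; proj₁; proj₂; uncurry)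
open import Data.Sum using (_⊎_; inj₁; inj₂; [_,_])
open import Data.Vec using (Vec; lookup)
open import Data.Vec.Properties using (lookup∘tabulate; tabulate-cong)
open import Data.Vec.Functional using (Vector; _++_; replicate)
open import Data.Vec.Functional.Properties using (lookup-++ˡ; lookup-++ʳ)
open import Function using (_∘_; _⇔_; Equivalence; mk⇔)
open import Level using (_⊔_; 0ℓ)
open import Relation.Binary.Bundles using (DecSetoid)
open import Relation.Binary.PropositionalEquality as ≡ using (_≡_)
open import Relation.Nullary using (Dec; does; yes; no; ¬_; ¬?; contradiction)
open import Relation.Nullary.Decidable using (does-⇔)
open import Relation.Unary using (Decidable)

open Equivalence using (to; from)

module Sums {c ℓ} (K : Semiring c ℓ) where
  open Semiring K hiding (zero) renaming (Carrier to C)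
  open import Algebra.Properties.Semiring.Sum K public
  open import Relation.Binary.Reasoning.Setoid setoid

  ∑-tabulate : ∀ {m n} (f : Vector C n) (h : Fin m → Fin n) →
               foldr (λ i s → f i + s) 0# (tabulate h) ≡ sum (f ∘ h)
  ∑-tabulate {zero}  f h = ≡.refl
  ∑-tabulate {suc m} f h = ≡.cong (f (h zero) +_) (∑-tabulate f (h ∘ suc))

  ∑≡sum : ∀ n (f : Vector C n) → ∑ K n f ≡ sum f
  ∑≡sum n f = ∑-tabulate f (λ i → i)

  sum-zero : ∀ {n} {f : Vector C n} → (∀ i → f i ≈ 0#) → sum f ≈ 0#
  sum-zero {n} f≈0 = trans (sum-cong-≋ f≈0) (sum-replicate-zero n)

  sum-↑ : ∀ m {n} (f : Vector C (m ℕ.+ n)) →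
          sum f ≈ sum (f ∘ (_↑ˡ n)) + sum (f ∘ (m ↑ʳ_))
  sum-↑ zero    f = sym (+-identityˡ _)
  sum-↑ (suc m) f = trans (+-congˡ (sum-↑ m (f ∘ suc))) (sym (+-assoc _ _ _))

  sum-combine : ∀ q r (f : Vector C (q ℕ.* r)) → sum f ≈ ∑[ s < q ] ∑[ i < r ] f (combine s i)
  sum-combine zero    r f = refl
  sum-combine (suc q) r f =
    trans (sum-↑ r f) (+-congˡ (sum-combine q r (f ∘ (r ↑ʳ_))))

  sum-select : ∀ {n} (i : Fin n) (f : Vector C n) → sum (λ j → identity K i j * f j) ≈ f i
  sum-select {suc n} zero f = begin
    1# * f zero + sum (λ j → 0# * f (suc j)) ≈⟨ +-cong (*-identityˡ _) (sum-zero {n} (λ j → zeroˡ _)) ⟩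
    f zero + 0#                              ≈⟨ +-identityʳ _ ⟩
    f zero                                   ∎
  sum-select {suc n} (suc i) f = begin
    0# * f zero + sum (λ j → identity K (suc i) (suc j) * f (suc j))
      ≈⟨ +-cong (zeroˡ _) (sum-cong-≋ (λ j → *-congʳ (reflexive (identity-suc j)))) ⟩
    0# + sum (λ j → identity K i j * f (suc j))   ≈⟨ +-identityˡ _ ⟩
    sum (λ j → identity K i j * f (suc j))        ≈⟨ sum-select i (f ∘ suc) ⟩
    f (suc i)                                     ∎
    where
    identity-suc : ∀ j → identity K (suc i) (suc j) ≡ identity K i j
    identity-suc j with i Fin.≟ j
    ... | yes _ = ≡.refl
    ... | no _  = ≡.refl

  infix 7 _·_
  _·_ : ∀ {n} → Vector C n → Vector C n → C
  u · v = sum (λ j → u j * v j)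

  ·-congʳ : ∀ {n} (u : Vector C n) {v v′ : Vector C n} → (∀ j → v j ≈ v′ j) → u · v ≈ u · v′
  ·-congʳ u v≈v′ = sum-cong-≋ (λ j → *-congˡ (v≈v′ j))

  ·-++ : ∀ {m n} (u₁ v₁ : Vector C m) (u₂ v₂ : Vector C n) →
         (u₁ ++ u₂) · (v₁ ++ v₂) ≈ u₁ · v₁ + u₂ · v₂
  ·-++ {m} u₁ v₁ u₂ v₂ = trans (sum-↑ m _) (+-cong
    (sum-cong-≋ (λ j → reflexive (≡.cong₂ _*_ (lookup-++ˡ u₁ u₂ j) (lookup-++ˡ v₁ v₂ j))))
    (sum-cong-≋ (λ j → reflexive (≡.cong₂ _*_ (lookup-++ʳ u₁ u₂ j) (lookup-++ʳ v₁ v₂ j)))))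

  ·-zeroˡ : ∀ {n} (v : Vector C n) → (λ _ → 0#) · v ≈ 0#
  ·-zeroˡ v = sum-zero (λ j → zeroˡ (v j))

  ·-if : ∀ {n} b (u v : Vector C n) → u · (λ j → if b then v j else 0#) ≈ (if b then u · v else 0#)
  ·-if true  u v = refl
  ·-if false u v = sum-zero (λ j → zeroʳ (u j))

  -- The Kronecker product of the unit vector at p₀ with u, indexed by combine.
  unit⊗ : ∀ {q r} → Fin q → Vector C r → Vector C (q ℕ.* r)
  unit⊗ {r = r} p₀ u t = uncurry (λ p i → identity K p₀ p * u i) (remQuot r t)

  unit⊗-· : ∀ {q r} (p₀ : Fin q) (u : Vector C r) (v : Vector C (q ℕ.* r)) →
             unit⊗ p₀ u · v ≈ u · (λ i → v (combine p₀ i))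
  unit⊗-· {q} {r} p₀ u v = begin
    unit⊗ p₀ u · v
      ≈⟨ sum-combine q r _ ⟩
    ∑[ p < q ] ∑[ i < r ] (unit⊗ p₀ u (combine p i) * v (combine p i))
      ≈⟨ sum-cong-≋ {q} (λ p → sum-cong-≋ {r} (λ i → *-congʳ (reflexive
           (≡.cong (uncurry (λ p i → identity K p₀ p * u i)) (remQuot-combine p i))))) ⟩
    ∑[ p < q ] ∑[ i < r ] ((identity K p₀ p * u i) * v (combine p i))
      ≈⟨ sum-cong-≋ {q} (λ p → trans (sum-cong-≋ {r} (λ i → *-assoc _ _ _)) (sym (*-distribˡ-sum {r} _ _))) ⟩
    ∑[ p < q ] (identity K p₀ p * (u · (λ i → v (combine p i))))
      ≈⟨ sum-select p₀ _ ⟩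
    u · (λ i → v (combine p₀ i)) ∎

saturatingSuc : ∀ {n} → Fin (suc n) → Fin (suc n)
saturatingSuc {zero}  zero    = zero
saturatingSuc {suc n} zero    = suc zero
saturatingSuc {suc n} (suc i) = suc (saturatingSuc i)

toℕ-saturatingSuc : ∀ {n} (i : Fin (suc n)) → toℕ (saturatingSuc i) ≡ suc (toℕ i) ℕ.⊓ n
toℕ-saturatingSuc {zero}  zero    = ≡.refl
toℕ-saturatingSuc {suc n} zero    = ≡.refl
toℕ-saturatingSuc {suc n} (suc i) = ≡.cong suc (toℕ-saturatingSuc i)

⊓-+-⊓ : ∀ x y n → (x ℕ.⊓ n ℕ.+ y) ℕ.⊓ n ≡ (x ℕ.+ y) ℕ.⊓ n
⊓-+-⊓ x y n = begin
  (x ℕ.⊓ n ℕ.+ y) ℕ.⊓ n               ≡⟨ ≡.cong (ℕ._⊓ n) (ℕₚ.+-distribʳ-⊓ y x n) ⟩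
  ((x ℕ.+ y) ℕ.⊓ (n ℕ.+ y)) ℕ.⊓ n     ≡⟨ ℕₚ.⊓-assoc (x ℕ.+ y) (n ℕ.+ y) n ⟩
  (x ℕ.+ y) ℕ.⊓ ((n ℕ.+ y) ℕ.⊓ n)     ≡⟨ ≡.cong ((x ℕ.+ y) ℕ.⊓_) (ℕₚ.m≥n⇒m⊓n≡n (ℕₚ.m≤m+n n y)) ⟩
  (x ℕ.+ y) ℕ.⊓ n                     ∎
  where open ≡.≡-Reasoning

toℕ-foldl-saturatingSuc : ∀ {A : Set} {n} (i : Fin (suc n)) (w : List A) →
  toℕ (foldl (λ j _ → saturatingSuc j) i w) ≡ (toℕ i ℕ.+ length w) ℕ.⊓ n
toℕ-foldl-saturatingSuc {n = n} i [] = begin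
  toℕ i                    ≡⟨ ℕₚ.m≤n⇒m⊓n≡m (toℕ≤pred[n] i) ⟨
  toℕ i ℕ.⊓ n              ≡⟨ ≡.cong (ℕ._⊓ n) (ℕₚ.+-identityʳ (toℕ i)) ⟨
  (toℕ i ℕ.+ 0) ℕ.⊓ n      ∎
  where open ≡.≡-Reasoning
toℕ-foldl-saturatingSuc {n = n} i (a ∷ w) = begin
  toℕ (foldl (λ j _ → saturatingSuc j) (saturatingSuc i) w)
    ≡⟨ toℕ-foldl-saturatingSuc (saturatingSuc i) w ⟩
  (toℕ (saturatingSuc i) ℕ.+ length w) ℕ.⊓ n
    ≡⟨ ≡.cong (λ t → (t ℕ.+ length w) ℕ.⊓ n) (toℕ-saturatingSuc i) ⟩
  (suc (toℕ i) ℕ.⊓ n ℕ.+ length w) ℕ.⊓ n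
    ≡⟨ ⊓-+-⊓ (suc (toℕ i)) (length w) n ⟩
  (suc (toℕ i) ℕ.+ length w) ℕ.⊓ n
    ≡⟨ ≡.cong (ℕ._⊓ n) (ℕₚ.+-suc (toℕ i) (length w)) ⟨
  (toℕ i ℕ.+ suc (length w)) ℕ.⊓ n
    ∎
  where open ≡.≡-Reasoning

<-⊓-suc⇔< : ∀ {m n} → m < n ℕ.⊓ suc m ⇔ m < n
<-⊓-suc⇔< {m} {n} =
  mk⇔ (λ m<n⊓ → ℕₚ.<-≤-trans m<n⊓ (ℕₚ.m⊓n≤m n (suc m))) (λ m<n → ℕₚ.⊓-glb m<n ℕₚ.≤-refl)

module Series {c ℓ} (K : Semiring c ℓ) (X : Set) where
  open Semiring K hiding (zero) renaming (Carrier to C)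
  open Sums K
  open import Relation.Binary.Reasoning.Setoid setoid

  act : ∀ {r} → (X → Mat K r) → Vector C r → List X → Vector C r
  act μ γ []        = γ
  act μ γ (a ∷ w) i = μ a i · act μ γ w

  -- act μ γ w is the column μ(w) γ, so α · act μ γ w is the coefficient λ μ(w) γ.
  Recognizable : (List X → C) → Set (c ⊔ ℓ)
  Recognizable h =
    ∃[ r ] Σ[ μ ∈ (X → Mat K r) ] Σ[ α ∈ Vector C r ] Σ[ γ ∈ Vector C r ]
      (∀ w → α · act μ γ w ≈ h w)

  μ*-act : ∀ {r} (μ : X → Mat K r) γ w i → (λ j → μ* K μ w i j) · γ ≈ act μ γ w i
  μ*-act {r} μ γ []      i = sum-select i γ
  μ*-act {r} μ γ (a ∷ w) i = begin
    ∑[ j < r ] (∑ K r (λ l → μ a i l * μ* K μ w l j) * γ j)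
      ≈⟨ sum-cong-≋ {r} (λ j → *-congʳ (reflexive (∑≡sum r _))) ⟩
    ∑[ j < r ] (∑[ l < r ] (μ a i l * μ* K μ w l j) * γ j)
      ≈⟨ sum-cong-≋ {r} (λ j → *-distribʳ-sum {r} (γ j) _) ⟩
    ∑[ j < r ] ∑[ l < r ] ((μ a i l * μ* K μ w l j) * γ j)
      ≈⟨ sum-cong-≋ {r} (λ j → sum-cong-≋ {r} (λ l → *-assoc _ _ _)) ⟩
    ∑[ j < r ] ∑[ l < r ] (μ a i l * (μ* K μ w l j * γ j))
      ≈⟨ ∑-comm {r} {r} _ ⟩
    ∑[ l < r ] ∑[ j < r ] (μ a i l * (μ* K μ w l j * γ j))
      ≈⟨ sum-cong-≋ {r} (λ l → sym (*-distribˡ-sum {r} _ _)) ⟩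
    ∑[ l < r ] (μ a i l * ((λ j → μ* K μ w l j) · γ))
      ≈⟨ ·-congʳ (μ a i) (μ*-act μ γ w) ⟩
    μ a i · act μ γ w ∎

  evalRep≈· : ∀ {r} (α : Vector C r) μ γ w → evalRep K α μ γ w ≈ α · act μ γ w
  evalRep≈· {r} α μ γ w = begin
    ∑ K r (λ i → ∑ K r (λ j → α i * (μ* K μ w i j * γ j)))
      ≈⟨ reflexive (∑≡sum r _) ⟩
    ∑[ i < r ] ∑ K r (λ j → α i * (μ* K μ w i j * γ j))
      ≈⟨ sum-cong-≋ {r} (λ i → reflexive (∑≡sum r _)) ⟩
    ∑[ i < r ] ∑[ j < r ] (α i * (μ* K μ w i j * γ j))
      ≈⟨ sum-cong-≋ {r} (λ i → sym (*-distribˡ-sum {r} (α i) _)) ⟩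
    ∑[ i < r ] (α i * ((λ j → μ* K μ w i j) · γ))
      ≈⟨ ·-congʳ α (μ*-act μ γ w) ⟩
    α · act μ γ w ∎

  evalRep-recognizable : ∀ {r} (α : Vector C r) μ γ → Recognizable (evalRep K α μ γ)
  evalRep-recognizable α μ γ = _ , μ , α , γ , λ w → sym (evalRep≈· α μ γ w)

  recognizable⇒evalRep : ∀ {h} → Recognizable h →
    ∃[ r ] Σ[ μ ∈ (X → Mat K r) ] Σ[ α ∈ Vector C r ] Σ[ γ ∈ Vector C r ] (∀ w → evalRep K α μ γ w ≈ h w)
  recognizable⇒evalRep (r , μ , α , γ , α·act≈h) =
    r , μ , α , γ , λ w → trans (evalRep≈· α μ γ w) (α·act≈h w)

  recognizable-cong : ∀ {h h′} → Recognizable h → (∀ w → h w ≈ h′ w) → Recognizable h′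
  recognizable-cong (r , μ , α , γ , α·act≈h) h≈h′ =
    r , μ , α , γ , λ w → trans (α·act≈h w) (h≈h′ w)

  recognizable-0 : Recognizable (λ _ → 0#)
  recognizable-0 = 0 , (λ _ ()) , (λ ()) , (λ ()) , λ _ → refl

  recognizable-+ : ∀ {h₁ h₂} → Recognizable h₁ → Recognizable h₂ →
                   Recognizable (λ w → h₁ w + h₂ w)
  recognizable-+ {h₁} {h₂} (r , μ₁ , α₁ , γ₁ , p₁) (s , μ₂ , α₂ , γ₂ , p₂) =
    r ℕ.+ s , μ , α₁ ++ α₂ , γ₁ ++ γ₂ , λ w → begin
      (α₁ ++ α₂) · act μ (γ₁ ++ γ₂) w              ≈⟨ ·-congʳ (α₁ ++ α₂) (act-++ w) ⟩
      (α₁ ++ α₂) · (act μ₁ γ₁ w ++ act μ₂ γ₂ w)   ≈⟨ ·-++ α₁ _ α₂ _ ⟩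
      α₁ · act μ₁ γ₁ w + α₂ · act μ₂ γ₂ w          ≈⟨ +-cong (p₁ w) (p₂ w) ⟩
      h₁ w + h₂ w                                  ∎
    where
    block : X → Fin r ⊎ Fin s → Vector C (r ℕ.+ s)
    block a = [ (λ i₁ → μ₁ a i₁ ++ replicate s 0#) , (λ i₂ → replicate r 0# ++ μ₂ a i₂) ]

    μ : X → Mat K (r ℕ.+ s)
    μ a i = block a (splitAt r i)

    act-++ : ∀ w i → act μ (γ₁ ++ γ₂) w i ≈ (act μ₁ γ₁ w ++ act μ₂ γ₂ w) i
    act-++ []      i = refl
    act-++ (a ∷ w) i = trans (·-congʳ (μ a i) (act-++ w)) (row (splitAt r i))
      where
      row : ∀ x → block a x · (act μ₁ γ₁ w ++ act μ₂ γ₂ w)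
                ≈ [ act μ₁ γ₁ (a ∷ w) , act μ₂ γ₂ (a ∷ w) ] x
      row (inj₁ i₁) = trans (·-++ (μ₁ a i₁) (act μ₁ γ₁ w) (replicate s 0#) (act μ₂ γ₂ w))
                        (trans (+-congˡ (·-zeroˡ (act μ₂ γ₂ w))) (+-identityʳ _))
      row (inj₂ i₂) = trans (·-++ (replicate r 0#) (act μ₁ γ₁ w) (μ₂ a i₂) (act μ₂ γ₂ w))
                        (trans (+-congʳ (·-zeroˡ (act μ₁ γ₁ w))) (+-identityˡ _))

  recognizable-restrict : ∀ {q h} (δ : Fin q → X → Fin q) (q₀ : Fin q) (final : Fin q → Bool) →
    Recognizable h → Recognizable (λ w → if final (foldl δ q₀ w) then h w else 0#)
  recognizable-restrict {q} {h} δ q₀ final (r , μ , α , γ , α·act≈h) =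
    q ℕ.* r , μ× , unit⊗ q₀ α , γ× , λ w → begin
      unit⊗ q₀ α · act μ× γ× w                        ≈⟨ unit⊗-· q₀ α _ ⟩
      α · (λ i → act μ× γ× w (combine q₀ i))           ≈⟨ ·-congʳ α (act-× w q₀) ⟩
      α · (λ i → accepted q₀ w (act μ γ w i))          ≈⟨ ·-if (final (foldl δ q₀ w)) α _ ⟩
      accepted q₀ w (α · act μ γ w)                    ≈⟨ accepted-cong (final (foldl δ q₀ w)) (α·act≈h w) ⟩
      accepted q₀ w (h w)                              ∎
    where
    accepted : Fin q → List X → C → C
    accepted p w x = if final (foldl δ p w) then x else 0#

    accepted-cong : ∀ b {x y} → x ≈ y → (if b then x else 0#) ≈ (if b then y else 0#)
    accepted-cong true  x≈y = x≈y
    accepted-cong false x≈y = refl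

    μ× : X → Mat K (q ℕ.* r)
    μ× a t = uncurry (λ p i → unit⊗ (δ p a) (μ a i)) (remQuot r t)

    γ× : Vector C (q ℕ.* r)
    γ× t = uncurry (λ p i → if final p then γ i else 0#) (remQuot r t)

    act-× : ∀ w p i → act μ× γ× w (combine p i) ≈ accepted p w (act μ γ w i)
    act-× []      p i = reflexive (≡.cong (uncurry (λ p i → if final p then γ i else 0#)) (remQuot-combine p i))
    act-× (a ∷ w) p i = begin
      μ× a (combine p i) · act μ× γ× w
        ≡⟨ ≡.cong (λ (p , i) → unit⊗ (δ p a) (μ a i) · act μ× γ× w) (remQuot-combine p i) ⟩
      unit⊗ (δ p a) (μ a i) · act μ× γ× w
        ≈⟨ unit⊗-· (δ p a) (μ a i) _ ⟩
      μ a i · (λ i′ → act μ× γ× w (combine (δ p a) i′))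
        ≈⟨ ·-congʳ (μ a i) (act-× w (δ p a)) ⟩
      μ a i · (λ i′ → accepted (δ p a) w (act μ γ w i′))
        ≈⟨ ·-if (final (foldl δ (δ p a) w)) (μ a i) _ ⟩
      accepted (δ p a) w (μ a i · act μ γ w) ∎

  infixr 5 _◁_
  _◁_ : (X → C) → (List X → C) → List X → C
  (κ ◁ h) []      = 0#
  (κ ◁ h) (a ∷ w) = κ a * h w

  recognizable-◁ : ∀ κ {h} → Recognizable h → Recognizable (κ ◁ h)
  recognizable-◁ κ {h} (r , μ , α , γ , α·act≈h) = suc r , μ′ , α′ , γ′ , λ w →
    trans (+-cong (*-identityˡ _) (·-zeroˡ (act μ′ γ′ w ∘ suc))) (trans (+-identityʳ _) (act-zero w))
    where
    μ′ : X → Mat K (suc r)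
    μ′ a zero    zero    = 0#
    μ′ a zero    (suc j) = κ a * α j
    μ′ a (suc i) zero    = 0#
    μ′ a (suc i) (suc j) = μ a i j

    α′ γ′ : Vector C (suc r)
    α′ zero    = 1#
    α′ (suc i) = 0#
    γ′ zero    = 0#
    γ′ (suc i) = γ i

    act-suc : ∀ w i → act μ′ γ′ w (suc i) ≈ act μ γ w i
    act-suc []      i = refl
    act-suc (a ∷ w) i = trans (+-cong (zeroˡ _) (·-congʳ (μ a i) (act-suc w))) (+-identityˡ _)

    act-zero : ∀ w → act μ′ γ′ w zero ≈ (κ ◁ h) w
    act-zero []      = refl
    act-zero (a ∷ w) = begin
      0# * act μ′ γ′ w zero + ∑[ j < r ] ((κ a * α j) * act μ′ γ′ w (suc j))
        ≈⟨ +-cong (zeroˡ _) (·-congʳ (λ j → κ a * α j) (act-suc w)) ⟩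
      0# + ∑[ j < r ] ((κ a * α j) * act μ γ w j)
        ≈⟨ +-identityˡ _ ⟩
      ∑[ j < r ] ((κ a * α j) * act μ γ w j)
        ≈⟨ sum-cong-≋ {r} (λ j → *-assoc _ _ _) ⟩
      ∑[ j < r ] (κ a * (α j * act μ γ w j))
        ≈⟨ sym (*-distribˡ-sum {r} (κ a) _) ⟩
      κ a * (α · act μ γ w)
        ≈⟨ *-congˡ (α·act≈h w) ⟩
      κ a * h w ∎

  onEmpty : C → List X → C
  onEmpty x []      = x
  onEmpty x (_ ∷ _) = 0#

  recognizable-onEmpty : ∀ x → Recognizable (onEmpty x)
  recognizable-onEmpty x = 1 , (λ _ _ _ → 0#) , (λ _ → 1#) , (λ _ → x) , α·act≈onEmpty
    where
    α·act≈onEmpty : ∀ w → (λ _ → 1#) · act {1} (λ _ _ _ → 0#) (λ _ → x) w ≈ onEmpty x w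
    α·act≈onEmpty []      = trans (+-identityʳ _) (*-identityˡ x)
    α·act≈onEmpty (_ ∷ _) = trans (+-identityʳ _) (trans (*-identityˡ _) (trans (+-identityʳ _) (zeroˡ _)))

  recognizable-long : ∀ N {h} → Recognizable h →
                      Recognizable (λ w → if does (N ℕₚ.<? length w) then h w else 0#)
  recognizable-long N {h} rec =
    recognizable-cong (recognizable-restrict (λ i _ → saturatingSuc i) zero long? rec) λ w →
      reflexive (≡.cong (λ b → if b then h w else 0#) (long?-run w))
    where
    long? : Fin (suc (suc N)) → Bool
    long? i = does (N ℕₚ.<? toℕ i)

    long?-run : ∀ w → long? (foldl (λ i _ → saturatingSuc i) zero w) ≡ does (N ℕₚ.<? length w)
    long?-run w = ≡.trans (≡.cong (λ m → does (N ℕₚ.<? m)) (toℕ-foldl-saturatingSuc zero w))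
      (does-⇔ <-⊓-suc⇔< (N ℕₚ.<? length w ℕ.⊓ suc N) (N ℕₚ.<? length w))

module FiniteSupport {c ℓ} (K : Semiring c ℓ) (A : DecSetoid 0ℓ 0ℓ) where
  open Semiring K hiding (zero) renaming (Carrier to C)
  open DecSetoid A using () renaming (Carrier to X; _≟_ to _≟ₓ_)
  open Series K X
  open DecSetoid (Pointwise.decSetoid A) public using ()
    renaming (_≈_ to _≋_; _≟_ to _≋?_; sym to ≋-sym; trans to ≋-trans)

  [_↦_] : List X → C → List X → C
  [ v ↦ x ] w = if does (w ≋? v) then x else 0#

  recognizable-[↦] : ∀ v x → Recognizable [ v ↦ x ]
  recognizable-[↦] []      x = recognizable-cong (recognizable-onEmpty x) λ { [] → refl ; (_ ∷ _) → refl }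
  recognizable-[↦] (b ∷ v) x = recognizable-cong (recognizable-◁ is-b (recognizable-[↦] v x)) agree
    where
    is-b : X → C
    is-b a = if does (a ≟ₓ b) then 1# else 0#

    agree : ∀ w → (is-b ◁ [ v ↦ x ]) w ≈ [ b ∷ v ↦ x ] w
    agree []      = refl
    agree (a ∷ w) with a ≟ₓ b | w ≋? v
    ... | yes _ | yes _ = *-identityˡ x
    ... | yes _ | no _  = *-identityˡ 0#
    ... | no _  | _     = zeroˡ _

  firstMatch : List (List X × C) → List X → C
  firstMatch []            w = 0#
  firstMatch ((v , x) ∷ t) w = if does (w ≋? v) then x else firstMatch t w

  sumOfSingles : List (List X × C) → List X → C
  sumOfSingles []            w = 0#
  sumOfSingles ((v , x) ∷ t) w = [ v ↦ x ] w + sumOfSingles t w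

  recognizable-sumOfSingles : ∀ t → Recognizable (sumOfSingles t)
  recognizable-sumOfSingles []            = recognizable-0
  recognizable-sumOfSingles ((v , x) ∷ t) =
    recognizable-+ (recognizable-[↦] v x) (recognizable-sumOfSingles t)

  sumOfSingles-none : ∀ {w} t → All (λ e → ¬ w ≋ proj₁ e) t → sumOfSingles t w ≈ 0#
  sumOfSingles-none {w} []            []                 = refl
  sumOfSingles-none {w} ((v , x) ∷ t) (w≉v ∷ unmatched) with w ≋? v
  ... | yes w≋v = contradiction w≋v w≉v
  ... | no _    = trans (+-identityˡ _) (sumOfSingles-none t unmatched)

  sumOfSingles-filter : ∀ {P : List X × C → Set} (P? : Decidable P) {w} t →
    (∀ e → ¬ P e → ¬ w ≋ proj₁ e) → sumOfSingles (filter P? t) w ≈ sumOfSingles t w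
  sumOfSingles-filter P? []            dropped⇒unmatched = refl
  sumOfSingles-filter P? {w} ((v , x) ∷ t) dropped⇒unmatched with P? (v , x)
  ... | yes _  = +-congˡ (sumOfSingles-filter P? t dropped⇒unmatched)
  ... | no ¬P with w ≋? v
  ...   | yes w≋v = contradiction w≋v (dropped⇒unmatched (v , x) ¬P)
  ...   | no _    = trans (sumOfSingles-filter P? t dropped⇒unmatched) (sym (+-identityˡ _))

  -- After deduplicating by word the single-word series of the entries are disjoint, so their sum
  -- reads off the first match.
  distinct : List (List X × C) → List (List X × C)
  distinct = deduplicate (λ e e′ → proj₁ e ≋? proj₁ e′)

  sumOfSingles-distinct : ∀ t w → sumOfSingles (distinct t) w ≈ firstMatch t w
  sumOfSingles-distinct []            w = refl
  sumOfSingles-distinct ((v , x) ∷ t) w with w ≋? v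
  ... | yes w≋v =
    trans (+-congˡ (sumOfSingles-none _ (All.map (λ {e} → unmatched {e})
                                                  (Allₚ.all-filter (λ e → ¬? (v ≋? proj₁ e)) (distinct t)))))
          (+-identityʳ x)
    where
    unmatched : ∀ {e : List X × C} → ¬ v ≋ proj₁ e → ¬ w ≋ proj₁ e
    unmatched v≉v′ w≋v′ = v≉v′ (≋-trans (≋-sym w≋v) w≋v′)
  ... | no w≉v =
    trans (+-identityˡ _) (trans (sumOfSingles-filter _ (distinct t) unmatched) (sumOfSingles-distinct t w))
    where
    unmatched : ∀ (e : List X × C) → ¬ ¬ v ≋ proj₁ e → ¬ w ≋ proj₁ e
    unmatched e ¬v≉v′ w≋v′ = ¬v≉v′ (λ v≋v′ → w≉v (≋-trans w≋v′ (≋-sym v≋v′)))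

  recognizable-firstMatch : ∀ t → Recognizable (firstMatch t)
  recognizable-firstMatch t =
    recognizable-cong (recognizable-sumOfSingles (distinct t)) (sumOfSingles-distinct t)

  firstMatch-none : ∀ {w} t → All (λ e → ¬ w ≋ proj₁ e) t → firstMatch t w ≈ 0#
  firstMatch-none {w} []            []                 = refl
  firstMatch-none {w} ((v , x) ∷ t) (w≉v ∷ unmatched) with w ≋? v
  ... | yes w≋v = contradiction w≋v w≉v
  ... | no _    = firstMatch-none t unmatched

  firstMatch-agree : ∀ {w y} t → All (λ e → w ≋ proj₁ e → proj₂ e ≈ y) t →
                     Any (λ e → w ≋ proj₁ e) t → firstMatch t w ≈ y
  firstMatch-agree {w} ((v , x) ∷ t) (x≈y ∷ agreeing) matched with w ≋? v
  ... | yes w≋v = x≈y w≋v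
  firstMatch-agree {w} ((v , x) ∷ t) (x≈y ∷ agreeing) (here w≋v)       | no w≉v = contradiction w≋v w≉v
  firstMatch-agree {w} ((v , x) ∷ t) (x≈y ∷ agreeing) (there matched′) | no w≉v =
    firstMatch-agree t agreeing matched′

module _ {A : Set} {P Q : A → Set} (P? : Decidable P) (Q? : Decidable Q) where

  count-mono : ∀ xs → (∀ {x} → x ∈ xs → P x → Q x) → length (filter P? xs) ≤ length (filter Q? xs)
  count-mono []       P⇒Q = z≤n
  count-mono (x ∷ xs) P⇒Q with P? x | Q? x
  ... | yes Px | yes _  = s≤s (count-mono xs (P⇒Q ∘ there))
  ... | yes Px | no ¬Qx = contradiction (P⇒Q (here ≡.refl) Px) ¬Qx
  ... | no _   | yes _  = ℕₚ.m≤n⇒m≤1+n (count-mono xs (P⇒Q ∘ there))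
  ... | no _   | no _   = count-mono xs (P⇒Q ∘ there)

  count-strict : ∀ xs → (∀ {x} → x ∈ xs → P x → Q x) → ∀ {y} → y ∈ xs → ¬ P y → Q y →
                 length (filter P? xs) < length (filter Q? xs)
  count-strict (x ∷ xs) P⇒Q (here ≡.refl) ¬Py Qy with P? x | Q? x
  ... | yes Py | _      = contradiction Py ¬Py
  ... | no _   | yes _  = s≤s (count-mono xs (P⇒Q ∘ there))
  ... | no _   | no ¬Qy = contradiction Qy ¬Qy
  count-strict (x ∷ xs) P⇒Q (there y∈xs) ¬Py Qy with P? x | Q? x
  ... | yes Px | yes _  = s≤s (count-strict xs (P⇒Q ∘ there) y∈xs ¬Py Qy)
  ... | yes Px | no ¬Qx = contradiction (P⇒Q (here ≡.refl) Px) ¬Qx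
  ... | no _   | yes _  = ℕₚ.m≤n⇒m≤1+n (count-strict xs (P⇒Q ∘ there) y∈xs ¬Py Qy)
  ... | no _   | no _   = count-strict xs (P⇒Q ∘ there) y∈xs ¬Py Qy

module _ {k : ℕ} where

  ∈-wordsOfLength : ∀ (w : List (Fin k)) → w ∈ wordsOfLength k (length w)
  ∈-wordsOfLength []      = here ≡.refl
  ∈-wordsOfLength (a ∷ w) =
    ∈-concatMap⁺ _ (Any.map (λ { ≡.refl → ∈-map⁺ (a ∷_) (∈-wordsOfLength w) }) (∈-allFin a))

  length-∈-wordsOfLength : ∀ l {w : List (Fin k)} → w ∈ wordsOfLength k l → length w ≡ l
  length-∈-wordsOfLength zero    (here ≡.refl) = ≡.refl
  length-∈-wordsOfLength (suc l) w∈
    with _ , w∈′ ← Any.satisfied (∈-concatMap⁻ _ {xs = allFin k} w∈)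
    with _ , v∈ , ≡.refl ← ∈-map⁻ _ w∈′ = ≡.cong suc (length-∈-wordsOfLength l v∈)

  ∈-wordsUpTo⁺ : ∀ {l} {w : List (Fin k)} → length w ≤ l → w ∈ wordsUpTo k l
  ∈-wordsUpTo⁺ {w = w} |w|≤l =
    ∈-concatMap⁺ (wordsOfLength k) (Any.map (λ { ≡.refl → ∈-wordsOfLength w }) (∈-upTo⁺ (s≤s |w|≤l)))

  ∈-wordsUpTo⁻ : ∀ l {w : List (Fin k)} → w ∈ wordsUpTo k l → length w ≤ l
  ∈-wordsUpTo⁻ l w∈ with m , m∈ , w∈′ ← find (∈-concatMap⁻ (wordsOfLength k) {xs = upTo (suc l)} w∈) =
    ≡.subst (_≤ l) (≡.sym (length-∈-wordsOfLength m w∈′)) (ℕₚ.≤-pred (∈-upTo⁻ m∈))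

  wordsUpTo-suc : ∀ l → wordsUpTo k (suc l) ≡ wordsUpTo k l List.++ wordsOfLength k (suc l)
  wordsUpTo-suc l = begin
    concatMap (wordsOfLength k) (upTo (suc (suc l)))
      ≡⟨ ≡.cong (concatMap (wordsOfLength k)) (≡.sym (Listₚ.upTo-∷ʳ (suc l))) ⟩
    concatMap (wordsOfLength k) (upTo (suc l) List.++ List.[ suc l ])
      ≡⟨ Listₚ.concatMap-++ (wordsOfLength k) (upTo (suc l)) List.[ suc l ] ⟩
    wordsUpTo k l List.++ (wordsOfLength k (suc l) List.++ [])
      ≡⟨ ≡.cong (wordsUpTo k l List.++_) (Listₚ.++-identityʳ _) ⟩
    wordsUpTo k l List.++ wordsOfLength k (suc l) ∎
    where open ≡.≡-Reasoning

  count-wordsUpTo-mono : ∀ {P : List (Fin k) → Set} (P? : Decidable P) {l l′} → l ≤ l′ →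
    length (filter P? (wordsUpTo k l)) ≤ length (filter P? (wordsUpTo k l′))
  count-wordsUpTo-mono P? l≤l′ = go (ℕₚ.≤⇒≤′ l≤l′)
    where
    go : ∀ {l l′} → l ℕ.≤′ l′ → length (filter P? (wordsUpTo k l)) ≤ length (filter P? (wordsUpTo k l′))
    go ℕ.≤′-refl = ℕₚ.≤-refl
    go {l} (ℕ.≤′-step {l′} l≤′l′) = ℕₚ.≤-trans (go l≤′l′) (begin
      length (filter P? (wordsUpTo k l′))
        ≤⟨ ℕₚ.m≤m+n _ _ ⟩
      length (filter P? (wordsUpTo k l′)) ℕ.+ length (filter P? (wordsOfLength k (suc l′)))
        ≡⟨ ≡.sym (Listₚ.length-++ (filter P? (wordsUpTo k l′))) ⟩
      length (filter P? (wordsUpTo k l′) List.++ filter P? (wordsOfLength k (suc l′)))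
        ≡⟨ ≡.cong length (≡.sym (Listₚ.filter-++ P? (wordsUpTo k l′) _)) ⟩
      length (filter P? (wordsUpTo k l′ List.++ wordsOfLength k (suc l′)))
        ≡⟨ ≡.cong (length ∘ filter P?) (≡.sym (wordsUpTo-suc l′)) ⟩
      length (filter P? (wordsUpTo k (suc l′))) ∎)
      where open ℕₚ.≤-Reasoning

  radLt-irrefl : ∀ (v : List (Fin k)) → ¬ T (radLt v v)
  radLt-irrefl v = irrefl (length v) (lexLt-irrefl v)
    where
    irrefl : ∀ n {c b} → ¬ T b → ¬ T ((n <ᵇ n) ∨ (c ∧ b))
    irrefl n ¬b n<n∨c∧b with to T-∨ n<n∨c∧b
    ... | inj₁ n<n = ℕₚ.<-irrefl ≡.refl (ℕₚ.<ᵇ⇒< n n n<n)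
    ... | inj₂ c∧b = ¬b (proj₂ (to T-∧ c∧b))

    lexLt-irrefl : ∀ (v : List (Fin k)) → ¬ T (lexLt v v)
    lexLt-irrefl []      ()
    lexLt-irrefl (a ∷ v) = irrefl (toℕ a) (lexLt-irrefl v)

  radLt-shorter : ∀ (u w : List (Fin k)) → length u < length w → T (radLt u w)
  radLt-shorter u w u<w = from T-∨ (inj₁ (ℕₚ.<⇒<ᵇ u<w))

val-< : ∀ (S : ANS) {v w} → accepts S v ≡ true → length v < length w → val S v < val S w
val-< S {v} {w} v∈L |v|<|w| = begin-strict
  val S v                                                   <⟨ fewer-before-v ⟩
  length (filter (before w) (wordsUpTo (k S) (length v)))   ≤⟨ count-wordsUpTo-mono (before w) (ℕₚ.<⇒≤ |v|<|w|) ⟩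
  val S w                                                   ∎
  where
  open ℕₚ.≤-Reasoning
  before : ∀ u → Decidable (λ x → T (accepts S x ∧ radLt x u))
  before u x = T? (accepts S x ∧ radLt x u)

  before-v⇒before-w : ∀ {x} → x ∈ wordsUpTo (k S) (length v) →
                      T (accepts S x ∧ radLt x v) → T (accepts S x ∧ radLt x w)
  before-v⇒before-w {x} x∈ x<v = from T-∧ (proj₁ (to T-∧ x<v) ,
    radLt-shorter x w (ℕₚ.≤-<-trans (∈-wordsUpTo⁻ (length v) x∈) |v|<|w|))

  -- v itself is counted for w but not for v.
  fewer-before-v : val S v < length (filter (before w) (wordsUpTo (k S) (length v)))
  fewer-before-v = count-strict (before v) (before w) _ before-v⇒before-w
    (∈-wordsUpTo⁺ {w = v} ℕₚ.≤-refl) (radLt-irrefl v ∘ proj₂ ∘ to T-∧)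
    (from T-∧ (from T-≡ v∈L , radLt-shorter v w |v|<|w|))

val-eventually-≥ : ∀ (S : ANS) m → ∃[ b ] ∀ w → accepts S w ≡ true → b ≤ length w → m ≤ val S w
val-eventually-≥ S zero    = 0 , λ _ _ _ → z≤n
val-eventually-≥ S (suc m)
  with b , m≤val ← val-eventually-≥ S m
  with v , b≤|v| , v∈L ← infinite S b =
  suc (length v) , λ w w∈L |v|<|w| → ℕₚ.≤-<-trans (m≤val v v∈L b≤|v|) (val-< S v∈L |v|<|w|)

length-bound : ∀ (S : ANS) m → ∃[ b ] ∀ w → accepts S w ≡ true → val S w ≤ m → length w < b
length-bound S m with b , large ← val-eventually-≥ S (suc m) =
  b , λ w w∈L val≤m → ℕₚ.≰⇒> (λ b≤|w| → ℕₚ.<⇒≱ (large w w∈L b≤|w|) val≤m)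

module _ {d : ℕ} {A : Fin (suc d) → Set} where

  prepend : A zero → ((i : Fin d) → A (suc i)) → (i : Fin (suc d)) → A i
  prepend x f zero    = x
  prepend x f (suc i) = f i

  prepend-≗ : ∀ {g : (i : Fin d) → A (suc i)} {f : (i : Fin (suc d)) → A i} →
              (∀ i → g i ≡ f (suc i)) → ∀ i → prepend (f zero) g i ≡ f i
  prepend-≗ g≗f zero    = ≡.refl
  prepend-≗ g≗f (suc i) = g≗f i

choices : ∀ {d} {A : Fin d → Set} → ((i : Fin d) → List (A i)) → List ((i : Fin d) → A i)
choices {zero}          ls = (λ ()) ∷ []
choices {suc d} {A = A} ls =
  concatMap (λ x → map (prepend x) (choices {A = A ∘ suc} (ls ∘ suc))) (ls zero)

choices-sound : ∀ {d} {A : Fin d → Set} (ls : (i : Fin d) → List (A i)) {f : (i : Fin d) → A i} →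
                f ∈ choices ls → ∀ i → f i ∈ ls i
choices-sound {suc d} {A} ls f∈ i
  with x , x∈ , f∈′ ← find (∈-concatMap⁻ (λ x → map (prepend x) (choices {A = A ∘ suc} (ls ∘ suc)))
                                         {xs = ls zero} f∈)
  with g , g∈ , ≡.refl ← ∈-map⁻ (prepend x) f∈′
  with i
... | zero  = x∈
... | suc j = choices-sound {A = A ∘ suc} (ls ∘ suc) g∈ j

choices-complete : ∀ {d} {A : Fin d → Set} (ls : (i : Fin d) → List (A i)) (f : (i : Fin d) → A i) →
                   (∀ i → f i ∈ ls i) → Any (λ g → ∀ i → g i ≡ f i) (choices ls)
choices-complete {zero}      ls f f∈ = here (λ ())
choices-complete {suc d} {A} ls f f∈ =
  Anyₚ.concatMap⁺ (λ x → map (prepend x) (choices {A = A ∘ suc} (ls ∘ suc)))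
    (Any.map (λ { ≡.refl → Anyₚ.map⁺ (Any.map prepend-≗
                             (choices-complete {A = A ∘ suc} (ls ∘ suc) (λ i → f (suc i)) (λ i → f∈ (suc i)))) })
             (f∈ zero))

module _ {A : Set} (f : A → ℕ) where

  ≤-foldr-⊔ : ∀ {x xs} → x ∈ xs → f x ≤ foldr (λ y m → f y ℕ.⊔ m) 0 xs
  ≤-foldr-⊔ (here ≡.refl) = ℕₚ.m≤m⊔n _ _
  ≤-foldr-⊔ {xs = y ∷ _} (there x∈) = ℕₚ.≤-trans (≤-foldr-⊔ x∈) (ℕₚ.m≤n⊔m (f y) _)

  foldr-⊔-≤ : ∀ {n} xs → (∀ {x} → x ∈ xs → f x ≤ n) → foldr (λ y m → f y ℕ.⊔ m) 0 xs ≤ n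
  foldr-⊔-≤ []       bounded = z≤n
  foldr-⊔-≤ (x ∷ xs) bounded = ℕₚ.⊔-lub (bounded (here ≡.refl)) (foldr-⊔-≤ xs (bounded ∘ there))

+-<ᵇ-false : ∀ m n → (m ℕ.+ n <ᵇ m) ≡ false
+-<ᵇ-false zero    n = ≡.refl
+-<ᵇ-false (suc m) n = +-<ᵇ-false m n

-- By definition, pad S ws = map (λ j i → padLetter (ws i) (maxLen S ws) j) (upTo (maxLen S ws)).
padLetter : ∀ {B : Set} → List B → ℕ → ℕ → Maybe B
padLetter u M j = if (j ℕ.+ length u) <ᵇ M then nothing else nth u ((j ℕ.+ length u) ℕ.∸ M)

catMaybes-leftPadded : ∀ {B : Set} (h : ℕ → Maybe B) (u : List B) p →
  (∀ j → j < p → h j ≡ nothing) → (∀ t → h (p ℕ.+ t) ≡ nth u t) →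
  catMaybes (applyUpTo h (p ℕ.+ length u)) ≡ u
catMaybes-leftPadded h []      zero    _       _     = ≡.refl
catMaybes-leftPadded h (x ∷ u) zero    _       h≡nth rewrite h≡nth 0 =
  ≡.cong (x ∷_) (catMaybes-leftPadded (h ∘ suc) u zero (λ _ ()) (h≡nth ∘ suc))
catMaybes-leftPadded h u       (suc p) h≡none  h≡nth rewrite h≡none 0 (s≤s z≤n) =
  catMaybes-leftPadded (h ∘ suc) u p (λ j j<p → h≡none (suc j) (s≤s j<p)) h≡nth

catMaybes-padLetter : ∀ {B : Set} (u : List B) M → length u ≤ M →
                      catMaybes (applyUpTo (padLetter u M) M) ≡ u
catMaybes-padLetter u M |u|≤M =
  ≡.subst (λ M′ → catMaybes (applyUpTo (padLetter u M) M′) ≡ u) (ℕₚ.m∸n+n≡m |u|≤M)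
    (catMaybes-leftPadded (padLetter u M) u (M ℕ.∸ L) padding letters)
  where
  L = length u
  padding : ∀ j → j < M ℕ.∸ L → padLetter u M j ≡ nothing
  padding j j<M∸L
    rewrite to T-≡ (ℕₚ.<⇒<ᵇ (≡.subst (j ℕ.+ L <_) (ℕₚ.m∸n+n≡m |u|≤M) (ℕₚ.+-monoˡ-< L j<M∸L)))
    = ≡.refl
  letters : ∀ t → padLetter u M (M ℕ.∸ L ℕ.+ t) ≡ nth u t
  letters t rewrite ℕₚ.+-assoc (M ℕ.∸ L) t L | ℕₚ.+-comm t L | ≡.sym (ℕₚ.+-assoc (M ℕ.∸ L) L t)
                  | ℕₚ.m∸n+n≡m |u|≤M | +-<ᵇ-false M t | ℕₚ.m+n∸m≡n M t = ≡.refl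

module Padding {d : ℕ} (S : Fin d → ANS) where

  private
    _≋_ : List (Letter S) → List (Letter S) → Set
    _≋_ = Pointwise (_≈L_ {S = S})

  length-≤-maxLen : ∀ ws i → length (ws i) ≤ maxLen S ws
  length-≤-maxLen ws i = ≤-foldr-⊔ (length ∘ ws) (∈-allFin i)

  maxLen-≤ : ∀ ws {n} → (∀ i → length (ws i) ≤ n) → maxLen S ws ≤ n
  maxLen-≤ ws short = foldr-⊔-≤ (length ∘ ws) (allFin d) (λ {i} _ → short i)

  length-pad : ∀ ws → length (pad S ws) ≡ maxLen S ws
  length-pad ws = ≡.trans (Listₚ.length-map _ (upTo (maxLen S ws))) (Listₚ.length-upTo _)

  pad-cong : ∀ {ws ws′} → (∀ i → ws i ≡ ws′ i) → pad S ws ≋ pad S ws′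
  pad-cong {ws} {ws′} ws≗ws′ =
    ≡.subst (λ M → pad S ws ≋ map (λ j i → padLetter (ws′ i) M j) (upTo M)) same-maxLen
      (Pointwise.map⁺ _ _ (Pointwise.refl λ {j} i → ≡.cong (λ u → padLetter u (maxLen S ws) j) (ws≗ws′ i)))
    where
    same-maxLen : maxLen S ws ≡ maxLen S ws′
    same-maxLen = Listₚ.foldr-cong (λ i m → ≡.cong (λ u → length u ℕ.⊔ m) (ws≗ws′ i)) ≡.refl (allFin d)

  track : List (Letter S) → (i : Fin d) → List (Fin (k (S i)))
  track w i = mapMaybe (λ a → a i) w

  track-pad : ∀ ws i → track (pad S ws) i ≡ ws i
  track-pad ws i = begin
    catMaybes (map (λ a → a i) (map (λ j i → padLetter (ws i) M j) (upTo M)))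
      ≡⟨ ≡.cong catMaybes (≡.sym (Listₚ.map-∘ (upTo M))) ⟩
    catMaybes (map (padLetter (ws i) M) (upTo M))
      ≡⟨ ≡.cong catMaybes (Listₚ.map-upTo (padLetter (ws i) M) M) ⟩
    catMaybes (applyUpTo (padLetter (ws i) M) M)
      ≡⟨ catMaybes-padLetter (ws i) M (length-≤-maxLen ws i) ⟩
    ws i ∎
    where
    open ≡.≡-Reasoning
    M = maxLen S ws

  track-cong : ∀ {u v} → u ≋ v → ∀ i → track u i ≡ track v i
  track-cong u≋v i =
    ≡.cong catMaybes (Pointwise.Pointwise-≡⇒≡ (Pointwise.map⁺ _ _ (Pointwise.map (λ a≈b → a≈b i) u≋v)))

  pad-injective : ∀ {ws ws′} → pad S ws ≋ pad S ws′ → ∀ i → ws i ≡ ws′ i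
  pad-injective {ws} {ws′} pads≋ i =
    ≡.trans (≡.sym (track-pad ws i)) (≡.trans (track-cong pads≋ i) (track-pad ws′ i))

letterSetoid : ∀ {d} (S : Fin d → ANS) → DecSetoid 0ℓ 0ℓ
letterSetoid S = record
  { Carrier          = Letter S
  ; _≈_              = _≈L_ {S = S}
  ; isDecEquivalence = record
    { isEquivalence = record
      { refl  = λ _ → ≡.refl
      ; sym   = λ a≈b i → ≡.sym (a≈b i)
      ; trans = λ a≈b b≈c i → ≡.trans (a≈b i) (b≈c i)
      }
    ; _≟_ = λ a b → all? (λ i → ≡-dec Fin._≟_ (a i) (b i))
    }
  }

module Patch {c ℓ} (K : Semiring c ℓ) {d} (S : Fin d → ANS)
             (g : Vec ℕ d → Semiring.Carrier K) (E : List (Vec ℕ d)) where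
  open Semiring K hiding (zero) renaming (Carrier to C)
  open Series K (Letter S)
  open FiniteSupport K (letterSetoid S)
  open Padding S

  componentBound : Vec ℕ d → Fin d → ℕ
  componentBound n i = proj₁ (length-bound (S i) (lookup n i))

  tupleBound : Vec ℕ d → ℕ
  tupleBound n = foldr (λ i m → componentBound n i ℕ.⊔ m) 0 (allFin d)

  N : ℕ
  N = foldr (λ n m → tupleBound n ℕ.⊔ m) 0 E

  exceptional⇒short : ∀ {ws} → InL S ws → vals S ws ∈ E → ∀ i → length (ws i) ≤ N
  exceptional⇒short {ws} ws∈L n∈E i = ℕₚ.<⇒≤ (begin-strict
    length (ws i)          <⟨ proj₂ (length-bound (S i) (lookup n i)) (ws i) (ws∈L i)
                                 (ℕₚ.≤-reflexive (≡.sym (lookup∘tabulate (λ i → val (S i) (ws i)) i))) ⟩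
    componentBound n i     ≤⟨ ≤-foldr-⊔ (componentBound n) (∈-allFin i) ⟩
    tupleBound n           ≤⟨ ≤-foldr-⊔ tupleBound n∈E ⟩
    N                      ∎)
    where
    open ℕₚ.≤-Reasoning
    n = vals S ws

  InL-resp : ∀ {ws ws′} → (∀ i → ws i ≡ ws′ i) → InL S ws → InL S ws′
  InL-resp ws≗ws′ ws∈L i = ≡.subst (λ u → accepts (S i) u ≡ true) (ws≗ws′ i) (ws∈L i)

  InL? : Decidable (InL S)
  InL? ws = all? (λ i → accepts (S i) (ws i) ≟ᵇ true)

  candidates : List (Words S)
  candidates = filter InL? (choices (λ i → wordsUpTo (k (S i)) N))

  candidate-sound : ∀ {ws} → ws ∈ candidates → InL S ws × (∀ i → length (ws i) ≤ N)
  candidate-sound ws∈ with ws∈choices , ws∈L ← ∈-filter⁻ InL? ws∈ =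
    ws∈L , λ i → ∈-wordsUpTo⁻ N (choices-sound (λ i → wordsUpTo (k (S i)) N) ws∈choices i)

  candidate-complete : ∀ {ws} → InL S ws → (∀ i → length (ws i) ≤ N) →
                       Any.Any (λ ws′ → ∀ i → ws′ i ≡ ws i) candidates
  candidate-complete {ws} ws∈L short
    with ws′ , ws′∈ , ws′≗ws
           ← find (choices-complete (λ i → wordsUpTo (k (S i)) N) ws (∈-wordsUpTo⁺ ∘ short)) =
    Any.map (λ { ≡.refl → ws′≗ws }) (∈-filter⁺ InL? ws′∈ (InL-resp (≡.sym ∘ ws′≗ws) ws∈L))

  table : List (List (Letter S) × C)
  table = map (λ ws → pad S ws , g (vals S ws)) candidates

  table-all : ∀ {p} {P : List (Letter S) × C → Set p} →
              (∀ {ws} → InL S ws → (∀ i → length (ws i) ≤ N) → P (pad S ws , g (vals S ws))) → All P table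
  table-all P-candidate = Allₚ.map⁺ (All.tabulate (λ ws∈ → uncurry P-candidate (candidate-sound ws∈)))

  patched : (List (Letter S) → C) → List (Letter S) → C
  patched F w = (if does (N ℕₚ.<? length w) then F w else 0#) + firstMatch table w

  recognizable-patched : ∀ {F} → Recognizable F → Recognizable (patched F)
  recognizable-patched rec = recognizable-+ (recognizable-long N rec) (recognizable-firstMatch table)

  module _ {F : List (Letter S) → C} {f : Vec ℕ d → C}
           (F-pad : ∀ ws → InL S ws → F (pad S ws) ≈ f (vals S ws))
           (F-other : ∀ w → All (NotAllHash {S = S}) w → (∀ ws → InL S ws → ¬ w ≋ pad S ws) → F w ≈ 0#)
           (g≈f : ∀ n → n ∉ E → g n ≈ f n) where

    patched-pad : ∀ ws → InL S ws → patched F (pad S ws) ≈ g (vals S ws)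
    patched-pad ws ws∈L = by-length (N ℕₚ.<? length (pad S ws))
      where
      by-length : ∀ (long? : Dec (N ℕ.< length (pad S ws))) →
                  (if does long? then F (pad S ws) else 0#) + firstMatch table (pad S ws) ≈ g (vals S ws)
      by-length (yes long) =
        trans (+-cong (trans (F-pad ws ws∈L) (sym (g≈f _ unexceptional))) unmatched) (+-identityʳ _)
        where
        unexceptional : vals S ws ∉ E
        unexceptional n∈E =
          ℕₚ.<⇒≱ long (≡.subst (_≤ N) (≡.sym (length-pad ws)) (maxLen-≤ ws (exceptional⇒short ws∈L n∈E)))
        unmatched : firstMatch table (pad S ws) ≈ 0#
        unmatched = firstMatch-none table (table-all λ {ws′} _ short′ pads≋ → ℕₚ.<⇒≱ long (begin
          length (pad S ws)   ≡⟨ Pointwise.Pointwise-length pads≋ ⟩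
          length (pad S ws′)  ≡⟨ length-pad ws′ ⟩
          maxLen S ws′        ≤⟨ maxLen-≤ ws′ short′ ⟩
          N                   ∎))
          where open ℕₚ.≤-Reasoning
      by-length (no short) = trans (+-identityˡ _) (firstMatch-agree table agreeing present)
        where
        agreeing : All (λ e → pad S ws ≋ proj₁ e → proj₂ e ≈ g (vals S ws)) table
        agreeing = table-all λ {ws′} _ _ pads≋ →
          reflexive (≡.cong g (tabulate-cong (λ i → ≡.cong (val (S i)) (≡.sym (pad-injective {ws} {ws′} pads≋ i)))))
        present : Any.Any (λ e → pad S ws ≋ proj₁ e) table
        present = Anyₚ.map⁺ (Any.map (λ {ws′} ws′≗ws → pad-cong {ws} {ws′} (λ i → ≡.sym (ws′≗ws i)))
          (candidate-complete ws∈L (λ i → ℕₚ.≤-trans (length-≤-maxLen ws i)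
                                            (≡.subst (_≤ N) (length-pad ws) (ℕₚ.≮⇒≥ short)))))

    patched-other : ∀ w → All (NotAllHash {S = S}) w → (∀ ws → InL S ws → ¬ w ≋ pad S ws) →
                    patched F w ≈ 0#
    patched-other w letters not-pad =
      trans (+-cong (long-part (does (N ℕₚ.<? length w))) unmatched) (+-identityˡ 0#)
      where
      long-part : ∀ b → (if b then F w else 0#) ≈ 0#
      long-part true  = F-other w letters not-pad
      long-part false = refl
      unmatched : firstMatch table w ≈ 0#
      unmatched = firstMatch-none table (table-all λ {ws} ws∈L _ → not-pad ws ws∈L)

  regular : ∀ {f} → Regular K S f → (∀ n → n ∉ E → g n ≈ f n) → Regular K S g
  regular (r , μ , α , γ , f-on-pads , f-elsewhere) g≈f
    with r′ , μ′ , α′ , γ′ , ≈patched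
           ← recognizable⇒evalRep (recognizable-patched (evalRep-recognizable α μ γ)) =
    r′ , μ′ , α′ , γ′ ,
    (λ ws ws∈L → trans (≈patched (pad S ws)) (patched-pad f-on-pads f-elsewhere g≈f ws ws∈L)) ,
    (λ w letters not-pad → trans (≈patched w) (patched-other f-on-pads f-elsewhere g≈f w letters not-pad))

proposition3p3 : ∀ {c ℓ} (K : Semiring c ℓ) (d : ℕ) → 1 ≤ d →
    (S : Fin d → ANS) (f g : Vec ℕ d → Semiring.Carrier K) →
    Regular K S f → AlmostEqual K g f → Regular K S g
proposition3p3 K d _ S f g f-regular (E , g≈f) = Patch.regular K S g E f-regular g≈f
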